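{- Let $\mathbf a=(a_i),\mathbf b=(b_i)\in\mathbb Z^k$ with $\mathbf a\preceq\mathbf b$, and let $e_t$, $e_{t,i}$, $f_{t,i}$, $c_{t,i}$ be defined by the construction below. Then for every $t\in[k]$: (1) the sequence $(f_{t,i})_{i\in[t]}$ is non-negative and non-increasing; (2) $c_{t,i}\le b_i$ for all $i\in[t]$.
   Context: $[k]=\{1,\dots,k\}$; $\mathbf a\preceq\mathbf b$ means $\sum_{i=1}^t a_i\le\sum_{i=1}^t b_i$ for all $t\in[k]$; $[x]_+=\max\{x,0\}$. Construction: for $t=1,\dots,k$ in turn, set $e_t=[a_t-b_t]_+$ and $f_{t,1}=e_t$; if $t\ge2$, for $i=1,\dots,t-1$ successively set $e_{t,i}=\min\{f_{t,i},\,b_i-c_{t-1,i}\}$, $f_{t,i+1}=f_{t,i}-e_{t,i}$, $c_{t,i}=c_{t-1,i}+e_{t,i}$; finally set $c_{t,t}=a_t-e_t$. (For $t=1$ only $e_1$, $f_{1,1}$ and $c_{1,1}=a_1-e_1$ are defined.) -}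

module Defs where

open import Data.Nat using (ℕ; zero; suc; _<?_)
open import Data.Fin using (Fin; fromℕ<)
open import Data.Integer using (ℤ; _+_; _-_; _⊔_; _⊓_; 0ℤ)
open import Relation.Nullary using (yes; no)

[_]₊ : ℤ → ℤ
[ x ]₊ = x ⊔ 0ℤ

-- 1-based view of a vector in ℤ^k: (ext a) i = a_i for i ∈ [k], junk 0 otherwise.
ext : {k : ℕ} → (Fin k → ℤ) → ℕ → ℤ
ext a zero = 0ℤ
ext {k} a (suc j) with j <? k
... | yes p = a (fromℕ< p)
... | no _  = 0ℤ

psum : (ℕ → ℤ) → ℕ → ℤ
psum x zero = 0ℤ
psum x (suc t) = psum x t + x (suc t)

module Construction (a b : ℕ → ℤ) where

  e : ℕ → ℤ
  e t = [ a t - b t ]₊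

  -- For fixed t, given the previous row cprev = c_{t-1,·}:
  --   fRow cprev t i = f_{t,i}  (meaningful for i ∈ [t])
  --   eRow cprev t i = e_{t,i}  (meaningful for i ∈ [t-1])
  fRow : (ℕ → ℤ) → ℕ → ℕ → ℤ
  eRow : (ℕ → ℤ) → ℕ → ℕ → ℤ
  fRow cprev t zero = 0ℤ
  fRow cprev t (suc zero) = e t
  fRow cprev t (suc (suc i)) = fRow cprev t (suc i) - eRow cprev t (suc i)
  eRow cprev t i = fRow cprev t i ⊓ (b i - cprev i)

  -- c t i = c_{t,i}  (meaningful for i ∈ [t]); row 0 is junk (never used meaningfully)
  c : ℕ → ℕ → ℤ
  c zero i = 0ℤ
  c (suc t) i with i <? suc t
  ... | yes _ = c t i + eRow (c t) (suc t) i
  ... | no _  = a (suc t) - e (suc t)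

  f : ℕ → ℕ → ℤ
  f zero i = 0ℤ
  f (suc t) i = fRow (c t) (suc t) i

  e₂ : ℕ → ℕ → ℤ
  e₂ zero i = 0ℤ
  e₂ (suc t) i = eRow (c t) (suc t) i

{-# OPTIONS --safe #-}
module Submission where

-- Since e_{t,i} ≤ f_{t,i}, every f_{t,i} stays non-negative; since c_{t−1,i} ≤ b_i (claim (2) for
-- the previous row), e_{t,i} ≥ 0 and the f_{t,i} decrease. Claim (2) itself is immediate:
-- c_{t,i} = c_{t−1,i} + e_{t,i} ≤ c_{t−1,i} + (b_i − c_{t−1,i}) = b_i, and c_{t,t} = a_t − [a_t − b_t]₊ ≤ b_t.
-- In particular neither claim uses the majorization a ⪯ b.

open import Defs
open import Data.Nat using (ℕ; zero; suc; _<?_; s≤s) renaming (_≤_ to _≤ℕ_; _<_ to _<ℕ_)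
open import Data.Nat.Properties using (≤-antisym; ≮⇒≥)
open import Data.Fin using (Fin)
open import Data.Integer using (ℤ; _≤_; 0ℤ; _+_; _-_; _⊓_; nonNegative)
open import Data.Integer.Properties
  using (≤-refl; +-monoʳ-≤; neg-mono-≤; i⊓j≤i; i⊓j≤j; i≤j⊔i; i≤i⊔j; ⊓-glb; i≤j⇒0≤j-i; i-j≤i)
open import Data.Integer.Tactic.RingSolver using (solve-∀)
open import Data.Product using (_×_; _,_)
open import Relation.Nullary using (yes; no)
open import Relation.Binary.PropositionalEquality using (_≡_; subst)

m+[n-m]≡n : ∀ m n → m + (n - m) ≡ n
m+[n-m]≡n = solve-∀

m-[m-n]≡n : ∀ m n → m - (m - n) ≡ n
m-[m-n]≡n = solve-∀

m+[n⊓[o-m]]≤o : ∀ m n o → m + (n ⊓ (o - m)) ≤ o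
m+[n⊓[o-m]]≤o m n o = subst (m + (n ⊓ (o - m)) ≤_) (m+[n-m]≡n m o) (+-monoʳ-≤ m (i⊓j≤j n (o - m)))

m-[m-n]₊≤n : ∀ m n → m - [ m - n ]₊ ≤ n
m-[m-n]₊≤n m n = subst (m - [ m - n ]₊ ≤_) (m-[m-n]≡n m n) (+-monoʳ-≤ m (neg-mono-≤ (i≤i⊔j (m - n) 0ℤ)))

0≤j⇒i-j≤i : ∀ i j → 0ℤ ≤ j → i - j ≤ i
0≤j⇒i-j≤i i j 0≤j = i-j≤i i j {{nonNegative 0≤j}}

module _ (a b : ℕ → ℤ) where
  open Construction a b

  fRow-nonneg : ∀ cprev t i → 1 ≤ℕ i → 0ℤ ≤ fRow cprev t i
  fRow-nonneg cprev t (suc zero)    _ = i≤j⊔i (a t - b t) 0ℤ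
  fRow-nonneg cprev t (suc (suc i)) _ = i≤j⇒0≤j-i (i⊓j≤i (fRow cprev t (suc i)) _)

  eRow-nonneg : ∀ cprev t i → 1 ≤ℕ i → cprev i ≤ b i → 0ℤ ≤ eRow cprev t i
  eRow-nonneg cprev t i 1≤i cprev≤b = ⊓-glb (fRow-nonneg cprev t i 1≤i) (i≤j⇒0≤j-i cprev≤b)

  fRow-antitone : ∀ cprev t i → 1 ≤ℕ i → cprev i ≤ b i → fRow cprev t (suc i) ≤ fRow cprev t i
  fRow-antitone cprev t (suc i) 1≤i cprev≤b =
    0≤j⇒i-j≤i (fRow cprev t (suc i)) _ (eRow-nonneg cprev t (suc i) 1≤i cprev≤b)

  c≤b : ∀ t i → 1 ≤ℕ i → i ≤ℕ t → c t i ≤ b i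
  c≤b zero    (suc i) _ ()
  c≤b (suc t) i _ i≤t+1 with i <? suc t
  ... | yes _ = m+[n⊓[o-m]]≤o (c t i) (fRow (c t) (suc t) i) (b i)
  ... | no i≮t+1 = subst (λ j → a (suc t) - e (suc t) ≤ b j)
                         (≤-antisym (≮⇒≥ i≮t+1) i≤t+1)
                         (m-[m-n]₊≤n (a (suc t)) (b (suc t)))

  f-nonneg : ∀ t i → 1 ≤ℕ i → 0ℤ ≤ f t i
  f-nonneg zero    i _   = ≤-refl
  f-nonneg (suc t) i 1≤i = fRow-nonneg (c t) (suc t) i 1≤i

  f-antitone : ∀ t i → 1 ≤ℕ i → i <ℕ t → f t (suc i) ≤ f t i
  f-antitone (suc t) i 1≤i (s≤s i≤t) = fRow-antitone (c t) (suc t) i 1≤i (c≤b t i 1≤i i≤t)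

lemma10 : (k : ℕ) (a b : Fin k → ℤ)
    → (∀ t → 1 ≤ℕ t → t ≤ℕ k → psum (ext a) t ≤ psum (ext b) t)
    → ∀ t → 1 ≤ℕ t → t ≤ℕ k
    → ((∀ i → 1 ≤ℕ i → i ≤ℕ t → 0ℤ ≤ Construction.f (ext a) (ext b) t i)
       × (∀ i → 1 ≤ℕ i → i <ℕ t → Construction.f (ext a) (ext b) t (suc i) ≤ Construction.f (ext a) (ext b) t i))
      × (∀ i → 1 ≤ℕ i → i ≤ℕ t → Construction.c (ext a) (ext b) t i ≤ ext b i)
lemma10 k a b _ t _ _ =
  ( (λ i 1≤i _ → f-nonneg (ext a) (ext b) t i 1≤i)
  , f-antitone (ext a) (ext b) t )
  , c≤b (ext a) (ext b) t
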